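{- Let $\mathcal{F}=[c_1,\dots,c_m]$ be an $n\times m$ Ferrers diagram with $m\ge 2$, and let $1\le r\le\min\{n,m\}$ be an integer with $\kappa(\mathcal{F},r)\ge1$. Let $\mathcal{F}'=[c_1,\dots,c_{m-1}]=\{(i,j)\in\mathcal{F}: j\le m-1\}$, viewed as a $c_{m-1}\times(m-1)$ Ferrers diagram, and for $1\le i\le c_{m-1}+m-2$ let $D_i'=\{(a,b)\in[c_{m-1}]\times[m-1]: b-a=m-1-i\}$ be the diagonals of the $c_{m-1}\times(m-1)$ board. Then $$\sum_{i=1}^{m+n-1}\min\{r,|D_i\cap\mathcal{F}|\}=\max\Big\{n+\sum_{i=1}^{c_{m-1}+m-2}\min\{r-1,|D_i'\cap\mathcal{F}'|\},\; r+\sum_{i=1}^{c_{m-1}+m-2}\min\{r,|D_i'\cap\mathcal{F}'|\}\Big\}.$$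
   Context: For a positive integer $i$, $[i]=\{1,\dots,i\}$. An $n\times m$ Ferrers diagram is a subset $\mathcal{F}\subseteq[n]\times[m]$ such that $(1,1),(n,m)\in\mathcal{F}$; if $(i,j)\in\mathcal{F}$ and $j<m$ then $(i,j+1)\in\mathcal{F}$; and if $(i,j)\in\mathcal{F}$ and $i>1$ then $(i-1,j)\in\mathcal{F}$. With $c_j=|\{i:(i,j)\in\mathcal{F}\}|$ one has $1\le c_1\le\dots\le c_m=n$, $\mathcal{F}=\{(i,j):i\le c_j\}$, and one writes $\mathcal{F}=[c_1,\dots,c_m]$. For $1\le d\le\min\{n,m\}$ and $0\le j\le d-1$ set $\kappa_j(\mathcal{F},d)=\sum_{t=1}^{m-d+1+j}\max\{c_t-j,0\}$ and $\kappa(\mathcal{F},d)=\min_{0\le j\le d-1}\kappa_j(\mathcal{F},d)$. For $1\le i\le m+n-1$, $D_i=\{(a,b)\in[n]\times[m]: b-a=m-i\}$. -}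

module Defs where

open import Data.Nat using (ℕ; zero; suc; _+_; _∸_; _≤_; _<_; _⊓_; _≡ᵇ_; _≤ᵇ_)
open import Data.Bool using (Bool; true; false; if_then_else_; _∧_)
open import Data.Product using (_×_)
open import Relation.Binary.PropositionalEquality using (_≡_)

-- A Ferrers diagram F = [c_1,...,c_m] is given by its column-height function
-- c : ℕ → ℕ; only the values c 1, ..., c m are ever used.

sumTo : ℕ → (ℕ → ℕ) → ℕ
sumTo zero    f = 0
sumTo (suc k) f = sumTo k f + f (suc k)

-- minBelow d f = min_{0 ≤ j ≤ d-1} f j  (d ≥ 1; value 0 for d = 0, never used)
minBelow : ℕ → (ℕ → ℕ) → ℕ
minBelow zero          f = 0
minBelow (suc zero)    f = f 0
minBelow (suc (suc k)) f = minBelow (suc k) f ⊓ f (suc k)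

IsFerrers : ℕ → ℕ → (ℕ → ℕ) → Set
IsFerrers n m c =
  (1 ≤ m) × (1 ≤ c 1) × (∀ t → 1 ≤ t → t < m → c t ≤ c (suc t)) × (c m ≡ n)

kappaJ : ℕ → (ℕ → ℕ) → ℕ → ℕ → ℕ
kappaJ m c d j = sumTo (m ∸ d + 1 + j) (λ t → c t ∸ j)

kappa : ℕ → (ℕ → ℕ) → ℕ → ℕ
kappa m c d = minBelow d (kappaJ m c d)

-- indicator of (a,b) ∈ D_i ∩ F on the n × m board, i.e. b - a = m - i
-- (written b + i = m + a) and a ≤ c_b
inDiag : ℕ → (ℕ → ℕ) → ℕ → ℕ → ℕ → ℕ
inDiag m c i a b = if ((b + i) ≡ᵇ (m + a)) ∧ (a ≤ᵇ c b) then 1 else 0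

diagCount : ℕ → ℕ → (ℕ → ℕ) → ℕ → ℕ
diagCount n m c i = sumTo m (λ b → sumTo n (λ a → inDiag m c i a b))

-- Deleting the last column of F shifts the diagonals by one: D_{t+1} ∩ F is D'_t ∩ F' together
-- with the cell (t+1, m) when t < n, and D_1 ∩ F is the single cell (1, m). With x_t = |D'_t ∩ F'|
-- the left side is therefore 1 + Σ_t min(r, x_t + [t < n]), and since x_t ≤ t, termwise
--   min(r, x_t + [t < n]) = max(min(r-1, x_t) + [t < n], min(r, x_t) + [t < r]).
-- The two arguments sum to n - 1 + Σ min(r-1, x_t) and r - 1 + Σ min(r, x_t), so it suffices that
-- one of them dominates for every t. Moving a cell of D'_{t+1} one column right, or one row up,
-- lands on D'_t; if D'_t misses a position, the cells of D'_{t+1} left of it move right and those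
-- right of it move up, so x_{t+1} ≤ x_t whenever x_t < t. Hence x_t ≥ r propagates down to every
-- t ≥ r, and whether x_n ≥ r decides which argument dominates.

module Submission where

open import Data.Bool using (if_then_else_; _∧_)
open import Data.Nat
open import Data.Nat.Properties
open import Algebra.Properties.CommutativeSemigroup +-commutativeSemigroup using (interchange)
open import Data.Product using (_×_; _,_)
open import Data.Sum using (_⊎_; inj₁; inj₂)
open import Function using (_∘_)
open import Relation.Nullary using (Dec; yes; no; does; ¬_; contradiction)
open import Relation.Nullary.Decidable using (_×-dec_)
open import Relation.Binary.PropositionalEquality

open import Defs

private variable
  P Q : Set

𝟙 : Dec P → ℕ
𝟙 d = if does d then 1 else 0

𝟙-yes : (d : Dec P) → P → 𝟙 d ≡ 1
𝟙-yes (yes _) _ = refl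
𝟙-yes (no ¬p) p = contradiction p ¬p

𝟙-no : (d : Dec P) → ¬ P → 𝟙 d ≡ 0
𝟙-no (yes p) ¬p = contradiction p ¬p
𝟙-no (no _)  _  = refl

𝟙≤1 : (d : Dec P) → 𝟙 d ≤ 1
𝟙≤1 (yes _) = ≤-refl
𝟙≤1 (no _)  = z≤n

𝟙-mono : (d : Dec P) (e : Dec Q) → (P → Q) → 𝟙 d ≤ 𝟙 e
𝟙-mono (yes p) e P→Q = ≤-reflexive (sym (𝟙-yes e (P→Q p)))
𝟙-mono (no _)  _ _   = z≤n

𝟙-cong : (d : Dec P) (e : Dec Q) → (P → Q) → (Q → P) → 𝟙 d ≡ 𝟙 e
𝟙-cong d e P→Q Q→P = ≤-antisym (𝟙-mono d e P→Q) (𝟙-mono e d Q→P)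

sumTo-cong : ∀ N {f g : ℕ → ℕ} → (∀ i → 1 ≤ i → i ≤ N → f i ≡ g i) → sumTo N f ≡ sumTo N g
sumTo-cong zero    _  = refl
sumTo-cong (suc N) eq =
  cong₂ _+_ (sumTo-cong N λ i 1≤i i≤N → eq i 1≤i (m≤n⇒m≤1+n i≤N)) (eq (suc N) (s≤s z≤n) ≤-refl)

sumTo-mono : ∀ N {f g : ℕ → ℕ} → (∀ i → f i ≤ g i) → sumTo N f ≤ sumTo N g
sumTo-mono zero    _   = z≤n
sumTo-mono (suc N) f≤g = +-mono-≤ (sumTo-mono N f≤g) (f≤g (suc N))

sumTo-zero : ∀ N {f : ℕ → ℕ} → (∀ i → 1 ≤ i → i ≤ N → f i ≡ 0) → sumTo N f ≡ 0
sumTo-zero zero    _   = refl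
sumTo-zero (suc N) f≡0 =
  cong₂ _+_ (sumTo-zero N λ i 1≤i i≤N → f≡0 i 1≤i (m≤n⇒m≤1+n i≤N)) (f≡0 (suc N) (s≤s z≤n) ≤-refl)

sumTo-single : ∀ N {f : ℕ → ℕ} {k} → 1 ≤ k → k ≤ N → (∀ i → i ≢ k → f i ≡ 0) → sumTo N f ≡ f k
sumTo-single zero    (s≤s _) ()
sumTo-single (suc N) {f} {k} 1≤k k≤1+N off with k ≟ suc N
... | yes refl = cong (_+ f k) (sumTo-zero N λ i _ i≤N → off i (<⇒≢ (s≤s i≤N)))
... | no  k≢1+N = begin
  sumTo N f + f (suc N) ≡⟨ cong₂ _+_ (sumTo-single N 1≤k k≤N off) (off (suc N) (k≢1+N ∘ sym)) ⟩
  f k + 0               ≡⟨ +-identityʳ (f k) ⟩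
  f k                   ∎
  where
  open ≡-Reasoning
  k≤N = s≤s⁻¹ (≤∧≢⇒< k≤1+N k≢1+N)

sumTo-truncate : ∀ {K N} {f : ℕ → ℕ} → K ≤ N → (∀ i → K < i → f i ≡ 0) → sumTo N f ≡ sumTo K f
sumTo-truncate {K} {f = f} K≤N f≡0 = go (≤⇒≤′ K≤N)
  where
  go : ∀ {N} → K ≤′ N → sumTo N f ≡ sumTo K f
  go ≤′-refl                    = refl
  go {suc N} (≤′-step K≤′N) =
    trans (cong₂ _+_ (go K≤′N) (f≡0 (suc N) (s≤s (≤′⇒≤ K≤′N)))) (+-identityʳ _)

sumTo-suc : ∀ N (f : ℕ → ℕ) → sumTo (suc N) f ≡ f 1 + sumTo N (f ∘ suc)
sumTo-suc zero    f = +-comm 0 (f 1)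
sumTo-suc (suc N) f = trans (cong (_+ f (suc (suc N))) (sumTo-suc N f)) (+-assoc (f 1) _ _)

sumTo-+ : ∀ N (f g : ℕ → ℕ) → sumTo N (λ i → f i + g i) ≡ sumTo N f + sumTo N g
sumTo-+ zero    f g = refl
sumTo-+ (suc N) f g =
  trans (cong (_+ (f (suc N) + g (suc N))) (sumTo-+ N f g))
        (interchange (sumTo N f) (sumTo N g) (f (suc N)) (g (suc N)))

sumTo-⊔ : ∀ N {f g : ℕ → ℕ} → (∀ i → f i ≤ g i) ⊎ (∀ i → g i ≤ f i) →
          sumTo N (λ i → f i ⊔ g i) ≡ sumTo N f ⊔ sumTo N g
sumTo-⊔ N (inj₁ f≤g) =
  trans (sumTo-cong N λ i _ _ → m≤n⇒m⊔n≡n (f≤g i)) (sym (m≤n⇒m⊔n≡n (sumTo-mono N f≤g)))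
sumTo-⊔ N (inj₂ g≤f) =
  trans (sumTo-cong N λ i _ _ → m≥n⇒m⊔n≡m (g≤f i)) (sym (m≥n⇒m⊔n≡m (sumTo-mono N g≤f)))

sumTo-𝟙≤ : ∀ N k → sumTo N (λ i → 𝟙 (i ≤? k)) ≡ k ⊓ N
sumTo-𝟙≤ zero    k = sym (⊓-zeroʳ k)
sumTo-𝟙≤ (suc N) k = last (suc N ≤? k)
  where
  open ≡-Reasoning
  last : (d : Dec (suc N ≤ k)) → sumTo N (λ i → 𝟙 (i ≤? k)) + 𝟙 d ≡ k ⊓ suc N
  last (yes 1+N≤k) = begin
    sumTo N (λ i → 𝟙 (i ≤? k)) + 1 ≡⟨ cong (_+ 1) (trans (sumTo-𝟙≤ N k) (m≥n⇒m⊓n≡n (<⇒≤ 1+N≤k))) ⟩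
    N + 1                          ≡⟨ +-comm N 1 ⟩
    suc N                          ≡⟨ m≥n⇒m⊓n≡n 1+N≤k ⟨
    k ⊓ suc N                      ∎
  last (no 1+N≰k) = begin
    sumTo N (λ i → 𝟙 (i ≤? k)) + 0 ≡⟨ +-identityʳ _ ⟩
    sumTo N (λ i → 𝟙 (i ≤? k))     ≡⟨ trans (sumTo-𝟙≤ N k) (m≤n⇒m⊓n≡m k≤N) ⟩
    k                              ≡⟨ m≤n⇒m⊓n≡m (m≤n⇒m≤1+n k≤N) ⟨
    k ⊓ suc N                      ∎
    where k≤N = s≤s⁻¹ (≰⇒> 1+N≰k)

module _ (x : ℕ → ℕ) (step : ∀ t → t ≤ x t ⊎ x (suc t) ≤ x t) where

  ≥-propagates-down : ∀ {R j i} → R ≤ j → j ≤ i → R ≤ x i → R ≤ x j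
  ≥-propagates-down {R} {j} R≤j j≤i = go (≤⇒≤′ j≤i)
    where
    go : ∀ {i} → j ≤′ i → R ≤ x i → R ≤ x j
    go ≤′-refl                R≤xi   = R≤xi
    go {suc i} (≤′-step j≤′i) R≤x1+i with step i
    ... | inj₁ i≤xi    = go j≤′i (≤-trans (≤-trans R≤j (≤′⇒≤ j≤′i)) i≤xi)
    ... | inj₂ x1+i≤xi = go j≤′i (≤-trans R≤x1+i x1+i≤xi)

  module _ (x≤id : ∀ t → x t ≤ t) {r n : ℕ} (r≤n : r ≤ n) where

    private
      ⊓-small : ∀ {y} → y ≤ r → r ⊓ y ≡ suc r ⊓ y
      ⊓-small y≤r = trans (m≥n⇒m⊓n≡n y≤r) (sym (m≥n⇒m⊓n≡n (m≤n⇒m≤1+n y≤r)))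

      ⊓-large : ∀ {y} → suc r ≤ y → suc (r ⊓ y) ≡ suc r ⊓ y
      ⊓-large 1+r≤y = trans (cong suc (m≤n⇒m⊓n≡m (<⇒≤ 1+r≤y))) (sym (m≤n⇒m⊓n≡m 1+r≤y))

      ⊓-suc-≤ : ∀ y → suc r ⊓ y ≤ suc (r ⊓ y)
      ⊓-suc-≤ zero    = z≤n
      ⊓-suc-≤ (suc y) = s≤s (⊓-monoʳ-≤ r (n≤1+n y))

      ⊓-≤-suc : ∀ y → r ⊓ y ≤ suc r ⊓ y
      ⊓-≤-suc y = ⊓-monoˡ-≤ y (n≤1+n r)

    ⊓-𝟙+-as-⊔ : ∀ t (t≤?n : Dec (t ≤ n)) (t≤?r : Dec (t ≤ r)) →
      suc r ⊓ (𝟙 t≤?n + x t) ≡ (𝟙 t≤?n + r ⊓ x t) ⊔ (𝟙 t≤?r + suc r ⊓ x t)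
    ⊓-𝟙+-as-⊔ t (yes _)    (yes t≤r) =
      cong suc (sym (m≥n⇒m⊔n≡m (≤-reflexive (sym (⊓-small (≤-trans (x≤id t) t≤r))))))
    ⊓-𝟙+-as-⊔ t (no t≰n)   (yes t≤r) = contradiction (≤-trans t≤r r≤n) t≰n
    ⊓-𝟙+-as-⊔ t (yes _)    (no _)    = sym (m≥n⇒m⊔n≡m (⊓-suc-≤ (x t)))
    ⊓-𝟙+-as-⊔ t (no _)     (no _)    = sym (m≤n⇒m⊔n≡n (⊓-≤-suc (x t)))

    -- Because x t ≥ suc r propagates down, it suffices to look at t = suc n.
    ⊔-summands-comparable :
        (∀ t → 𝟙 (t ≤? n) + r ⊓ x t ≤ 𝟙 (t ≤? r) + suc r ⊓ x t)
      ⊎ (∀ t → 𝟙 (t ≤? r) + suc r ⊓ x t ≤ 𝟙 (t ≤? n) + r ⊓ x t)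
    ⊔-summands-comparable with suc r ≤? x (suc n)
    ... | yes 1+r≤x1+n = inj₁ λ t → first≤second t (t ≤? n) (t ≤? r)
      where
      first≤second : ∀ t (t≤?n : Dec (t ≤ n)) (t≤?r : Dec (t ≤ r)) →
                     𝟙 t≤?n + r ⊓ x t ≤ 𝟙 t≤?r + suc r ⊓ x t
      first≤second t (yes _)   (yes _)   = s≤s (⊓-≤-suc (x t))
      first≤second t (no t≰n)  (yes t≤r) = contradiction (≤-trans t≤r r≤n) t≰n
      first≤second t (yes t≤n) (no t≰r)  =
        ≤-reflexive (⊓-large (≥-propagates-down (≰⇒> t≰r) (m≤n⇒m≤1+n t≤n) 1+r≤x1+n))
      first≤second t (no _)    (no _)    = ⊓-≤-suc (x t)
    ... | no 1+r≰x1+n = inj₂ λ t → second≤first t (t ≤? n) (t ≤? r)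
      where
      second≤first : ∀ t (t≤?n : Dec (t ≤ n)) (t≤?r : Dec (t ≤ r)) →
                     𝟙 t≤?r + suc r ⊓ x t ≤ 𝟙 t≤?n + r ⊓ x t
      second≤first t (yes _)   (yes t≤r) = ≤-reflexive (cong suc (sym (⊓-small (≤-trans (x≤id t) t≤r))))
      second≤first t (no t≰n)  (yes t≤r) = contradiction (≤-trans t≤r r≤n) t≰n
      second≤first t (yes _)   (no _)    = ⊓-suc-≤ (x t)
      second≤first t (no t≰n)  (no _)    = ≤-reflexive (sym (⊓-small (≮⇒≥ λ r<xt →
        1+r≰x1+n (≥-propagates-down (s≤s r≤n) (≰⇒> t≰n) r<xt))))

    sumTo-⊓-𝟙+ : ∀ N → n ≤ N →
      sumTo N (λ t → suc r ⊓ (𝟙 (t ≤? n) + x t))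
        ≡ (n + sumTo N (λ t → r ⊓ x t)) ⊔ (r + sumTo N (λ t → suc r ⊓ x t))
    sumTo-⊓-𝟙+ N n≤N = begin
      sumTo N (λ t → suc r ⊓ (𝟙 (t ≤? n) + x t))
        ≡⟨ sumTo-cong N (λ t _ _ → ⊓-𝟙+-as-⊔ t (t ≤? n) (t ≤? r)) ⟩
      sumTo N (λ t → (𝟙 (t ≤? n) + r ⊓ x t) ⊔ (𝟙 (t ≤? r) + suc r ⊓ x t))
        ≡⟨ sumTo-⊔ N ⊔-summands-comparable ⟩
      sumTo N (λ t → 𝟙 (t ≤? n) + r ⊓ x t) ⊔ sumTo N (λ t → 𝟙 (t ≤? r) + suc r ⊓ x t)
        ≡⟨ cong₂ _⊔_ (sumTo-𝟙≤-+ n≤N) (sumTo-𝟙≤-+ (≤-trans r≤n n≤N)) ⟩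
      (n + sumTo N (λ t → r ⊓ x t)) ⊔ (r + sumTo N (λ t → suc r ⊓ x t)) ∎
      where
      open ≡-Reasoning
      sumTo-𝟙≤-+ : ∀ {k} {u : ℕ → ℕ} → k ≤ N → sumTo N (λ t → 𝟙 (t ≤? k) + u t) ≡ k + sumTo N u
      sumTo-𝟙≤-+ {k} {u} k≤N =
        trans (sumTo-+ N _ u) (cong (_+ sumTo N u) (trans (sumTo-𝟙≤ N k) (m≤n⇒m⊓n≡m k≤N)))

NondecreasingOn : ℕ → (ℕ → ℕ) → Set
NondecreasingOn m c = ∀ t → 1 ≤ t → t < m → c t ≤ c (suc t)

nondecreasing-≤ : ∀ {m c a b} → NondecreasingOn m c → 1 ≤ a → a ≤ b → b ≤ m → c a ≤ c b
nondecreasing-≤ {m} {c} {a} mono 1≤a a≤b = go (≤⇒≤′ a≤b)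
  where
  go : ∀ {b} → a ≤′ b → b ≤ m → c a ≤ c b
  go ≤′-refl              _     = ≤-refl
  go (≤′-step {b} a≤′b) 1+b≤m =
    ≤-trans (go a≤′b (<⇒≤ 1+b≤m)) (mono b (≤-trans 1≤a (≤′⇒≤ a≤′b)) 1+b≤m)

module Diagonals (M : ℕ) (c : ℕ → ℕ) where

  -- Column b meets diagonal t (b - a = M - t) in row a = b + t - M, and that cell lies in the
  -- diagram iff 1 ≤ a ≤ c b.
  Cell : ℕ → ℕ → Set
  Cell t b = M < b + t × b + t ≤ M + c b

  cell? : ∀ t b → Dec (Cell t b)
  cell? t b = (M <? b + t) ×-dec (b + t ≤? M + c b)

  column-count : ∀ {h} t b → c b ≤ h → sumTo h (λ a → inDiag M c t a b) ≡ 𝟙 (cell? t b)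
  column-count {h} t b cb≤h = count (cell? t b)
    where
    count : (d : Dec (Cell t b)) → sumTo h (λ a → inDiag M c t a b) ≡ 𝟙 d
    count (yes (M<b+t , b+t≤M+cb)) =
      trans (sumTo-single h 1≤k (≤-trans k≤cb cb≤h) off)
            (𝟙-yes ((b + t ≟ M + k) ×-dec (k ≤? c b)) (sym M+k≡b+t , k≤cb))
      where
      k = b + t ∸ M
      M+k≡b+t : M + k ≡ b + t
      M+k≡b+t = m+[n∸m]≡n (<⇒≤ M<b+t)
      1≤k : 1 ≤ k
      1≤k = m<n⇒0<n∸m M<b+t
      k≤cb : k ≤ c b
      k≤cb = +-cancelˡ-≤ M k (c b) (subst (_≤ M + c b) (sym M+k≡b+t) b+t≤M+cb)
      off : ∀ a → a ≢ k → inDiag M c t a b ≡ 0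
      off a a≢k = 𝟙-no ((b + t ≟ M + a) ×-dec (a ≤? c b))
        λ (b+t≡M+a , _) → a≢k (+-cancelˡ-≡ M a k (trans (sym b+t≡M+a) (sym M+k≡b+t)))
    count (no ¬cell) = sumTo-zero h λ a 1≤a _ → 𝟙-no ((b + t ≟ M + a) ×-dec (a ≤? c b))
      λ (b+t≡M+a , a≤cb) → ¬cell ( subst (M <_) (sym b+t≡M+a) (m<m+n M 1≤a)
                                 , subst (_≤ M + c b) (sym b+t≡M+a) (+-monoʳ-≤ M a≤cb))

  cellsUpTo : ℕ → ℕ → ℕ
  cellsUpTo t s = sumTo s (λ b → 𝟙 (cell? t b))

  diagCount-cells : ∀ {h} t → (∀ b → 1 ≤ b → b ≤ M → c b ≤ h) → diagCount h M c t ≡ cellsUpTo t M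
  diagCount-cells t cb≤h = sumTo-cong M λ b 1≤b b≤M → column-count t b (cb≤h b 1≤b b≤M)

  cellsUpTo-≤ : ∀ t s → cellsUpTo t s ≤ s + t ∸ M
  cellsUpTo-≤ t zero    = z≤n
  cellsUpTo-≤ t (suc s) = extend (cell? t (suc s))
    where
    open ≤-Reasoning
    extend : (d : Dec (Cell t (suc s))) → cellsUpTo t s + 𝟙 d ≤ suc s + t ∸ M
    extend (yes (M<1+s+t , _)) = begin
      cellsUpTo t s + 1 ≤⟨ +-monoˡ-≤ 1 (cellsUpTo-≤ t s) ⟩
      s + t ∸ M + 1     ≡⟨ +-comm _ 1 ⟩
      suc (s + t ∸ M)   ≡⟨ +-∸-assoc 1 (s≤s⁻¹ M<1+s+t) ⟨
      suc s + t ∸ M     ∎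
    extend (no _) = begin
      cellsUpTo t s + 0 ≡⟨ +-identityʳ _ ⟩
      cellsUpTo t s     ≤⟨ cellsUpTo-≤ t s ⟩
      s + t ∸ M         ≤⟨ ∸-monoˡ-≤ M (n≤1+n (s + t)) ⟩
      suc s + t ∸ M     ∎

  cell-shift↑ : ∀ {t b} → M < b + t → Cell (suc t) b → Cell t b
  cell-shift↑ {t} {b} M<b+t (_ , b+1+t≤M+cb) =
    M<b+t , ≤-trans (n≤1+n (b + t)) (subst (_≤ M + c b) (+-suc b t) b+1+t≤M+cb)

  module WithNondecreasing (mono : NondecreasingOn M c) where

    cell-shiftʳ : ∀ {t b} → 1 ≤ b → b < M → Cell (suc t) b → Cell t (suc b)
    cell-shiftʳ {t} {b} 1≤b b<M (M<b+1+t , b+1+t≤M+cb) =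
        subst (M <_) (+-suc b t) M<b+1+t
      , ≤-trans (subst (_≤ M + c b) (+-suc b t) b+1+t≤M+cb) (+-monoʳ-≤ M (mono b 1≤b b<M))

    cellsUpTo-shiftʳ : ∀ t s → s < M → cellsUpTo (suc t) s ≤ cellsUpTo t (suc s)
    cellsUpTo-shiftʳ t zero    _     = z≤n
    cellsUpTo-shiftʳ t (suc s) 1+s<M =
      +-mono-≤ (cellsUpTo-shiftʳ t s (<-trans (n<1+n s) 1+s<M))
               (𝟙-mono (cell? (suc t) (suc s)) (cell? t (suc (suc s))) (cell-shiftʳ (s≤s z≤n) 1+s<M))

    -- s + t ∸ M is the number of positions of diagonal t in the first s columns, so the right
    -- disjunct says that all of them are cells.
    cellsUpTo-step : ∀ t s → s ≤ M → cellsUpTo (suc t) s ≤ cellsUpTo t s ⊎ s + t ∸ M ≤ cellsUpTo t s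
    cellsUpTo-step t zero    _     = inj₁ z≤n
    cellsUpTo-step t (suc s) 1+s≤M = extend (cell? t (suc s)) (M <? suc s + t)
      where
      open ≤-Reasoning
      extend : (d : Dec (Cell t (suc s))) → Dec (M < suc s + t) →
               cellsUpTo (suc t) (suc s) ≤ cellsUpTo t s + 𝟙 d ⊎ suc s + t ∸ M ≤ cellsUpTo t s + 𝟙 d
      extend (yes (M<1+s+t , _)) _ with cellsUpTo-step t s (<⇒≤ 1+s≤M)
      ... | inj₁ below = inj₁ (+-mono-≤ below (𝟙≤1 (cell? (suc t) (suc s))))
      ... | inj₂ full  = inj₂ (begin
        suc s + t ∸ M     ≡⟨ +-∸-assoc 1 (s≤s⁻¹ M<1+s+t) ⟩
        suc (s + t ∸ M)   ≡⟨ +-comm 1 _ ⟩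
        s + t ∸ M + 1     ≤⟨ +-monoˡ-≤ 1 full ⟩
        cellsUpTo t s + 1 ∎)
      extend (no ¬cell) (yes M<1+s+t) = inj₁ (begin
        cellsUpTo (suc t) (suc s) ≡⟨ cong (cellsUpTo (suc t) s +_)
                                          (𝟙-no (cell? (suc t) (suc s)) (¬cell ∘ cell-shift↑ M<1+s+t)) ⟩
        cellsUpTo (suc t) s + 0   ≡⟨ +-identityʳ _ ⟩
        cellsUpTo (suc t) s       ≤⟨ cellsUpTo-shiftʳ t s 1+s≤M ⟩
        cellsUpTo t (suc s)       ≡⟨ cong (cellsUpTo t s +_) (𝟙-no (cell? t (suc s)) ¬cell) ⟩
        cellsUpTo t s + 0         ∎)
      extend (no _) (no M≮1+s+t) = inj₂ (≤-trans (≤-reflexive (m≤n⇒m∸n≡0 (≮⇒≥ M≮1+s+t))) z≤n)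

    diagLength : ℕ → ℕ
    diagLength = diagCount (c M) M c

    diagLength≡cellsUpTo : ∀ t → diagLength t ≡ cellsUpTo t M
    diagLength≡cellsUpTo t = diagCount-cells t λ b 1≤b b≤M → nondecreasing-≤ mono 1≤b b≤M ≤-refl

    diagLength-≤ : ∀ t → diagLength t ≤ t
    diagLength-≤ t = subst₂ _≤_ (sym (diagLength≡cellsUpTo t)) (m+n∸m≡n M t) (cellsUpTo-≤ t M)

    diagLength-step : ∀ t → t ≤ diagLength t ⊎ diagLength (suc t) ≤ diagLength t
    diagLength-step t rewrite diagLength≡cellsUpTo t | diagLength≡cellsUpTo (suc t)
      with cellsUpTo-step t M ≤-refl
    ... | inj₁ below = inj₂ below
    ... | inj₂ full  = inj₁ (subst (_≤ cellsUpTo t M) (m+n∸m≡n M t) full)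

    diagLength-vanishes : ∀ {t} → M + c M ≤ t → diagLength t ≡ 0
    diagLength-vanishes {t} M+cM≤t =
      trans (diagLength≡cellsUpTo t) (sumTo-zero M λ b 1≤b b≤M → 𝟙-no (cell? t b) λ (_ , b+t≤M+cb) →
        <⇒≱ (m<n+m t 1≤b)
            (≤-trans b+t≤M+cb (≤-trans (+-monoʳ-≤ M (nondecreasing-≤ mono 1≤b b≤M ≤-refl)) M+cM≤t)))

    sumTo-⊓-diagLength-truncate : ∀ k {N} → c M + suc M ∸ 2 ≤ N →
      sumTo N (λ t → k ⊓ diagLength t) ≡ sumTo (c M + suc M ∸ 2) (λ t → k ⊓ diagLength t)
    sumTo-⊓-diagLength-truncate k K≤N =
      sumTo-truncate K≤N λ i K<i → trans (cong (k ⊓_) (diagLength-vanishes (reach i K<i))) (⊓-zeroʳ k)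
      where
      reach : ∀ i → c M + suc M ∸ 2 < i → M + c M ≤ i
      reach i K<i = begin
        M + c M                  ≡⟨ +-comm M (c M) ⟩
        c M + M                  ≤⟨ m≤n+m∸n (c M + M) 1 ⟩
        suc (c M + M ∸ 1)        ≡⟨ cong (λ j → suc (j ∸ 2)) (+-suc (c M) M) ⟨
        suc (c M + suc M ∸ 2)    ≤⟨ K<i ⟩
        i                        ∎
        where open ≤-Reasoning

inDiag-suc : ∀ M c t a b → inDiag (suc M) c (suc t) a b ≡ inDiag M c t a b
inDiag-suc M c t a b = cong (λ k → if (k ≡ᵇ suc (M + a)) ∧ (a ≤ᵇ c b) then 1 else 0) (+-suc b t)

diagCount-suc : ∀ {n M c} t → NondecreasingOn (suc M) c → c (suc M) ≡ suc n →
                diagCount (suc n) (suc M) c (suc t) ≡ 𝟙 (t ≤? n) + diagCount (c M) M c t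
diagCount-suc {n} {M} {c} t mono cm = begin
  diagCount (suc n) (suc M) c (suc t)
    ≡⟨ cong₂ _+_ (sumTo-cong M λ b _ _ → sumTo-cong (suc n) λ a _ _ → inDiag-suc M c t a b) lastColumn ⟩
  diagCount (suc n) M c t + 𝟙 (t ≤? n)
    ≡⟨ cong (_+ 𝟙 (t ≤? n)) (trans (diagCount-cells t below-n) (sym (diagCount-cells t below-cM))) ⟩
  diagCount (c M) M c t + 𝟙 (t ≤? n)
    ≡⟨ +-comm _ (𝟙 (t ≤? n)) ⟩
  𝟙 (t ≤? n) + diagCount (c M) M c t ∎
  where
  open ≡-Reasoning
  open Diagonals M c using (diagCount-cells)
  below-n : ∀ b → 1 ≤ b → b ≤ M → c b ≤ suc n
  below-n b 1≤b b≤M = subst (c b ≤_) cm (nondecreasing-≤ mono 1≤b (m≤n⇒m≤1+n b≤M) ≤-refl)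
  below-cM : ∀ b → 1 ≤ b → b ≤ M → c b ≤ c M
  below-cM b 1≤b b≤M = nondecreasing-≤ mono 1≤b b≤M (n≤1+n M)
  lastColumn : sumTo (suc n) (λ a → inDiag (suc M) c (suc t) a (suc M)) ≡ 𝟙 (t ≤? n)
  lastColumn = trans (column-count (suc t) (suc M) (≤-reflexive cm))
    (𝟙-cong (cell? (suc t) (suc M)) (t ≤? n)
    (λ (_ , ≤n) → s≤s⁻¹ (subst (suc t ≤_) cm (+-cancelˡ-≤ (suc M) (suc t) (c (suc M)) ≤n)))
    (λ t≤n → m<m+n (suc M) (s≤s z≤n) , +-monoʳ-≤ (suc M) (subst (suc t ≤_) (sym cm) (s≤s t≤n))))
    where open Diagonals (suc M) c using (column-count; cell?)

-- In the main clause n and r stand for the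
-- paper's n - 1 and r - 1, and F' has suc M columns.
lemma2p16 : (n m : ℕ) (c : ℕ → ℕ) (r : ℕ) → IsFerrers n m c → 2 ≤ m → 1 ≤ r → r ≤ n ⊓ m → 1 ≤ kappa m c r →
    sumTo (m + n ∸ 1) (λ i → r ⊓ diagCount n m c i)
      ≡ (n + sumTo (c (m ∸ 1) + m ∸ 2) (λ i → (r ∸ 1) ⊓ diagCount (c (m ∸ 1)) (m ∸ 1) c i))
        ⊔ (r + sumTo (c (m ∸ 1) + m ∸ 2) (λ i → r ⊓ diagCount (c (m ∸ 1)) (m ∸ 1) c i))
lemma2p16 zero    _             _ (suc _) _ _ (s≤s z≤n) () _
lemma2p16 (suc n) (suc (suc M)) c (suc r) (_ , _ , mono , cm) (s≤s (s≤s z≤n)) (s≤s z≤n) r≤n⊓m _ = begin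
    sumTo (suc N) (λ i → suc r ⊓ diagCount (suc n) (suc (suc M)) c i)
  ≡⟨ sumTo-suc N _ ⟩
    suc r ⊓ diagCount (suc n) (suc (suc M)) c 1
      + sumTo N (λ t → suc r ⊓ diagCount (suc n) (suc (suc M)) c (suc t))
  ≡⟨ cong₂ _+_ firstDiagonal (sumTo-cong N λ t _ _ → cong (suc r ⊓_) (diagCount-suc t mono cm)) ⟩
    suc (sumTo N (λ t → suc r ⊓ (𝟙 (t ≤? n) + diagLength t)))
  ≡⟨ cong suc (sumTo-⊓-𝟙+ diagLength diagLength-step diagLength-≤ r≤n N n≤N) ⟩
    suc ((n + sumTo N (λ t → r ⊓ diagLength t)) ⊔ (r + sumTo N (λ t → suc r ⊓ diagLength t)))
  ≡⟨ cong₂ (λ u v → suc ((n + u) ⊔ (r + v))) (sumTo-⊓-diagLength-truncate r K≤N)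
                                              (sumTo-⊓-diagLength-truncate (suc r) K≤N) ⟩
    (suc n + sumTo K (λ t → r ⊓ diagLength t)) ⊔ (suc r + sumTo K (λ t → suc r ⊓ diagLength t)) ∎
  where
  open ≡-Reasoning
  open Diagonals (suc M) c
  open WithNondecreasing (λ t 1≤t 1+t≤1+M → mono t 1≤t (m≤n⇒m≤1+n 1+t≤1+M))
  N = M + suc n
  K = c (suc M) + suc (suc M) ∸ 2
  r≤n : r ≤ n
  r≤n = s≤s⁻¹ (≤-trans r≤n⊓m (m⊓n≤m (suc n) _))
  n≤N : n ≤ N
  n≤N = ≤-trans (n≤1+n n) (m≤n+m (suc n) M)
  K≤N : K ≤ N
  K≤N = ≤-trans (≤-reflexive (cong (_∸ 2) (trans (+-suc (c (suc M)) (suc M))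
                                                  (cong suc (+-suc (c (suc M)) M)))))
                (≤-trans (+-monoˡ-≤ M (subst (c (suc M) ≤_) cm (mono (suc M) (s≤s z≤n) ≤-refl)))
                         (≤-reflexive (+-comm (suc n) M)))
  firstDiagonal : suc r ⊓ diagCount (suc n) (suc (suc M)) c 1 ≡ 1
  firstDiagonal = trans (cong (suc r ⊓_) (diagCount-suc 0 mono cm))
                        (cong suc (trans (cong (r ⊓_) (n≤0⇒n≡0 (diagLength-≤ 0))) (⊓-zeroʳ r)))
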